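{- Let $G$ be a finite simple graph with girth at least $15$ and minimum degree $\delta(G)\ge 2$. Then $G$ has two maximal open packings of different cardinalities.
   Context: A set $P$ of vertices is an open packing if no two distinct vertices of $P$ have a common neighbor; a maximal open packing is one maximal under inclusion. The girth is the length of a shortest cycle. -}

module Defs where

open import Data.Nat using (ℕ; zero; suc; _≤_)
open import Data.Bool using (Bool; true; false; T)
open import Data.Fin using (Fin; zero; suc; inject₁; fromℕ)
open import Data.Fin.Subset using (Subset; _∈_; _∉_; ∣_∣; _∪_; ⁅_⁆)
open import Data.Vec using (tabulate)
open import Data.Product using (Σ; _×_; ∃)
open import Function.Definitions using (Injective)
open import Relation.Binary.PropositionalEquality using (_≡_; _≢_)
open import Relation.Nullary using (¬_)

record SimpleGraph (n : ℕ) : Set where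
  field
    adj    : Fin n → Fin n → Bool
    sym    : ∀ u v → adj u v ≡ adj v u
    irrefl : ∀ v → adj v v ≡ false

module _ {n : ℕ} (G : SimpleGraph n) where
  open SimpleGraph G

  Adj : Fin n → Fin n → Set
  Adj u v = T (adj u v)

  nbhd : Fin n → Subset n
  nbhd v = tabulate (adj v)

  degree : Fin n → ℕ
  degree v = ∣ nbhd v ∣

  MinDegreeAtLeast : ℕ → Set
  MinDegreeAtLeast k = ∀ v → k ≤ degree v

  IsCycle : (m : ℕ) → (Fin (suc m) → Fin n) → Set
  IsCycle m c =
    (3 ≤ suc m) × Injective _≡_ _≡_ c ×
    (∀ (i : Fin m) → Adj (c (inject₁ i)) (c (suc i))) ×
    Adj (c (fromℕ m)) (c zero)

  -- girth at least g (vacuous for acyclic graphs: girth = ∞)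
  GirthAtLeast : ℕ → Set
  GirthAtLeast g = ∀ (m : ℕ) (c : Fin (suc m) → Fin n) → IsCycle m c → g ≤ suc m

  IsOpenPacking : Subset n → Set
  IsOpenPacking P = ∀ u v → u ∈ P → v ∈ P → u ≢ v →
    ¬ (∃ λ w → Adj u w × Adj v w)

  IsMaximalOpenPacking : Subset n → Set
  IsMaximalOpenPacking P = IsOpenPacking P ×
    (∀ (Q : Subset n) → IsOpenPacking Q → (∀ {x} → x ∈ P → x ∈ Q) →
       ∀ {x} → x ∈ Q → x ∈ P)

module Submission where

-- Fix a root vertex p.  In a graph of girth ≥ 15 non-backtracking
-- walks of length ≤ 7 are determined by their two ends (unique-walk), and
-- minimum degree ≥ 2 gives, for all x, y, a neighbour `next x y` of x other
-- than y, so every non-backtracking walk extends by one step.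
--   1. The seed consists of p and, for every non-backtracking walk
--      r ∷ t ∷ … of length 5 ending at p, the vertex next r t.  By uniqueness
--      of short walks the seed is an open packing; extend it greedily to a
--      maximal open packing P.
--   2. No vertex t ending a 4-walk to p lies in P: r = next t u ends a 5-walk,
--      so next r t ∈ P shares the neighbour r with t.
--   3. Pick neighbours w₁ ≠ w₂ of p and neighbours yᵢ ≠ p of wᵢ.  Then
--      Q = P − p + y₁ + y₂ is again an open packing (by 2 and uniqueness of
--      short walks) and |Q| = |P| + 1; a maximal extension of Q is a maximal
--      open packing of size different from |P|.

open import Defs
open import Data.Nat using (ℕ; zero; suc; _≤_; _<_; _+_; z≤n; s≤s; _≤?_) renaming (_≟_ to _ℕ≟_)
import Data.Nat.Properties as ℕP
open import Data.Fin using (Fin; zero; suc; inject₁; fromℕ; _≟_)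
open import Data.Fin.Subset
  using (Subset; ∣_∣; _∈_; _∉_; inside; outside; ⁅_⁆; _∪_; _⊆_)
open import Data.Fin.Subset.Properties
  using (p⊆q⇒∣p∣≤∣q∣; ∣⁅x⁆∣≡1; x∈⁅x⁆; x∈⁅y⁆⇒x≡y; p⊆p∪q; q⊆p∪q; x∈p∪q⁻; _∈?_)
open import Data.Fin.Properties using (any?; all?; suc-injective)
open import Data.Product using (Σ; _×_; _,_; proj₁; proj₂)
open import Data.Sum using (_⊎_; inj₁; inj₂)
import Data.Sum as Sum
open import Data.Bool using (Bool; T)
open import Data.Bool.Properties using (T-≡)
open import Data.List using (List; []; _∷_; _++_; _ʳ++_; length; lookup; allFin)
open import Data.List.Membership.Propositional renaming (_∈_ to _∈L_; _∉_ to _∉L_)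
open import Data.List.Membership.Propositional.Properties
  using (∈-allFin; ∈-lookup; ∈-++⁺ˡ)
import Data.List.Relation.Unary.Any as Any
import Data.List.Properties as LP
open import Data.Vec using (tabulate; _∷_; _[_]≔_; here; there)
import Data.Vec.Properties as VP
open import Function.Bundles using (Equivalence)
open import Relation.Binary.PropositionalEquality
open import Relation.Nullary using (Dec; yes; no; ¬_; ¬?)
open import Relation.Nullary.Decidable
  using (_×-dec_; _⊎-dec_; _→-dec_; T?; ⌊_⌋; True; False; toWitness; fromWitness; toWitnessFalse)
open import Relation.Unary using (Decidable)
open import Data.Empty using (⊥; ⊥-elim)
open import Data.Unit using (⊤; tt)

subsetOf : ∀ {n} {P : Fin n → Set} → Decidable P → Subset n
subsetOf P? = tabulate (λ x → ⌊ P? x ⌋)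

∈-tabulate⁺ : ∀ {n} (f : Fin n → Bool) {x} → T (f x) → x ∈ tabulate f
∈-tabulate⁺ f {x} fx =
  VP.lookup⇒[]= x (tabulate f) (trans (VP.lookup∘tabulate f x) (Equivalence.to T-≡ fx))

∈-tabulate⁻ : ∀ {n} (f : Fin n → Bool) {x} → x ∈ tabulate f → T (f x)
∈-tabulate⁻ f {x} x∈ =
  Equivalence.from T-≡ (trans (sym (VP.lookup∘tabulate f x)) (VP.[]=⇒lookup x∈))

∈-subsetOf⁺ : ∀ {n} {P : Fin n → Set} (P? : Decidable P) {x} → P x → x ∈ subsetOf P?
∈-subsetOf⁺ P? {x} px = ∈-tabulate⁺ _ (fromWitness {a? = P? x} px)

∈-subsetOf⁻ : ∀ {n} {P : Fin n → Set} (P? : Decidable P) {x} → x ∈ subsetOf P? → P x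
∈-subsetOf⁻ P? {x} x∈ = toWitness {a? = P? x} (∈-tabulate⁻ _ x∈)

∈-insert⁻ : ∀ {n} (v : Subset n) y {x} → x ∈ v [ y ]≔ inside → x ≡ y ⊎ x ∈ v
∈-insert⁻ (b ∷ v) zero    here      = inj₁ refl
∈-insert⁻ (b ∷ v) zero    (there m) = inj₂ (there m)
∈-insert⁻ (b ∷ v) (suc y) here      = inj₂ here
∈-insert⁻ (b ∷ v) (suc y) (there m) = Sum.map (cong suc) there (∈-insert⁻ v y m)

∈-remove⁻ : ∀ {n} (v : Subset n) y {x} → x ∈ v [ y ]≔ outside → x ≢ y × x ∈ v
∈-remove⁻ (b ∷ v) zero    (there m) = (λ ()) , there m
∈-remove⁻ (b ∷ v) (suc y) here      = (λ ()) , here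
∈-remove⁻ (b ∷ v) (suc y) (there m) with ∈-remove⁻ v y m
... | x≢y , x∈v = (λ e → x≢y (suc-injective e)) , there x∈v

∣insert∣ : ∀ {n} (v : Subset n) y → y ∉ v → ∣ v [ y ]≔ inside ∣ ≡ suc ∣ v ∣
∣insert∣ (inside  ∷ v) zero    y∉v = ⊥-elim (y∉v here)
∣insert∣ (outside ∷ v) zero    y∉v = refl
∣insert∣ (inside  ∷ v) (suc y) y∉v = cong suc (∣insert∣ v y (λ m → y∉v (there m)))
∣insert∣ (outside ∷ v) (suc y) y∉v = ∣insert∣ v y (λ m → y∉v (there m))

∣remove∣ : ∀ {n} (v : Subset n) y → y ∈ v → suc ∣ v [ y ]≔ outside ∣ ≡ ∣ v ∣
∣remove∣ (inside  ∷ v) zero    here      = refl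
∣remove∣ (inside  ∷ v) (suc y) (there m) = cong suc (∣remove∣ v y m)
∣remove∣ (outside ∷ v) (suc y) (there m) = ∣remove∣ v y m

module Graph {n : ℕ} (G : SimpleGraph n) where
  open SimpleGraph G using (adj; irrefl)

  V : Set
  V = Fin n

  adj-sym : ∀ {u v} → Adj G u v → Adj G v u
  adj-sym {u} {v} = subst T (SimpleGraph.sym G u v)

  adj-irrefl : ∀ {v} → ¬ Adj G v v
  adj-irrefl {v} a = subst T (irrefl v) a

  adj? : ∀ u v → Dec (Adj G u v)
  adj? u v = T? (adj u v)

  openPacking? : ∀ P → Dec (IsOpenPacking G P)
  openPacking? P = all? λ u → all? λ v →
    (u ∈? P) →-dec (v ∈? P) →-dec ¬? (u ≟ v) →-dec
    ¬? (any? λ w → adj? u w ×-dec adj? v w)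

  openPacking-⊆ : ∀ {A B} → A ⊆ B → IsOpenPacking G B → IsOpenPacking G A
  openPacking-⊆ A⊆B opB u v u∈ v∈ = opB u v (A⊆B u∈) (A⊆B v∈)

  -- Greedy extension: scan the vertices and add each one that keeps the set an
  -- open packing.  A vertex that was rejected stays rejected, which gives
  -- maximality.
  tryAdd : Subset n → V → Subset n
  tryAdd S x with openPacking? (S ∪ ⁅ x ⁆)
  ... | yes _ = S ∪ ⁅ x ⁆
  ... | no  _ = S

  data TryAddSpec (S : Subset n) (x : V) : Subset n → Set where
    added    : IsOpenPacking G (S ∪ ⁅ x ⁆) → TryAddSpec S x (S ∪ ⁅ x ⁆)
    rejected : ¬ IsOpenPacking G (S ∪ ⁅ x ⁆) → TryAddSpec S x S

  tryAdd-spec : ∀ S x → TryAddSpec S x (tryAdd S x)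
  tryAdd-spec S x with openPacking? (S ∪ ⁅ x ⁆)
  ... | yes op = added op
  ... | no ¬op = rejected ¬op

  tryAdd-⊇ : ∀ S x → S ⊆ tryAdd S x
  tryAdd-⊇ S x x∈ with tryAdd S x | tryAdd-spec S x
  ... | _ | added _    = p⊆p∪q ⁅ x ⁆ x∈
  ... | _ | rejected _ = x∈

  tryAdd-op : ∀ S x → IsOpenPacking G S → IsOpenPacking G (tryAdd S x)
  tryAdd-op S x opS with tryAdd S x | tryAdd-spec S x
  ... | _ | added op   = op
  ... | _ | rejected _ = opS

  greedy : Subset n → List V → Subset n
  greedy S []       = S
  greedy S (x ∷ xs) = greedy (tryAdd S x) xs

  greedy-⊇ : ∀ S xs → S ⊆ greedy S xs
  greedy-⊇ S []       x∈ = x∈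
  greedy-⊇ S (x ∷ xs) x∈ = greedy-⊇ (tryAdd S x) xs (tryAdd-⊇ S x x∈)

  greedy-op : ∀ S xs → IsOpenPacking G S → IsOpenPacking G (greedy S xs)
  greedy-op S []       opS = opS
  greedy-op S (x ∷ xs) opS = greedy-op (tryAdd S x) xs (tryAdd-op S x opS)

  greedy-decided : ∀ S xs {x} → x ∈L xs → x ∈ greedy S xs ⊎
    Σ (Subset n) λ S′ → S′ ⊆ greedy S xs × ¬ IsOpenPacking G (S′ ∪ ⁅ x ⁆)
  greedy-decided S (x ∷ xs) (Any.here refl) with tryAdd S x | tryAdd-spec S x
  ... | _ | added _    = inj₁ (greedy-⊇ _ xs (q⊆p∪q S ⁅ x ⁆ (x∈⁅x⁆ x)))
  ... | _ | rejected r = inj₂ (S , greedy-⊇ S xs , r)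
  greedy-decided S (y ∷ xs) (Any.there x∈xs) = greedy-decided (tryAdd S y) xs x∈xs

  extendToMaximal : ∀ S → IsOpenPacking G S →
    Σ (Subset n) λ P → S ⊆ P × IsMaximalOpenPacking G P
  extendToMaximal S opS = P , greedy-⊇ S vs , greedy-op S vs opS , maximal
    where
    vs = allFin n
    P  = greedy S vs
    maximal : ∀ Q → IsOpenPacking G Q → (∀ {x} → x ∈ P → x ∈ Q) → ∀ {x} → x ∈ Q → x ∈ P
    maximal Q opQ P⊆Q {x} x∈Q with greedy-decided S vs (∈-allFin x)
    ... | inj₁ x∈P = x∈P
    ... | inj₂ (S′ , S′⊆P , ¬op) = ⊥-elim (¬op (openPacking-⊆ S′+x⊆Q opQ))
      where
      S′+x⊆Q : (S′ ∪ ⁅ x ⁆) ⊆ Q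
      S′+x⊆Q y∈ with x∈p∪q⁻ S′ ⁅ x ⁆ y∈
      ... | inj₁ y∈S′ = P⊆Q (S′⊆P y∈S′)
      ... | inj₂ y∈x  = subst (_∈ Q) (sym (x∈⁅y⁆⇒x≡y x y∈x)) x∈Q

  data NBWalk : List V → Set where
    nil    : NBWalk []
    single : ∀ {x} → NBWalk (x ∷ [])
    edge   : ∀ {x y} → Adj G x y → NBWalk (x ∷ y ∷ [])
    step   : ∀ {x y z l} → Adj G x y → x ≢ z → NBWalk (y ∷ z ∷ l) →
             NBWalk (x ∷ y ∷ z ∷ l)

  NoBacktrack : V → List V → Set
  NoBacktrack x (_ ∷ z ∷ _) = x ≢ z
  NoBacktrack x _           = ⊤

  nbWalk? : ∀ l → Dec (NBWalk l)
  nbWalk? []              = yes nil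
  nbWalk? (x ∷ [])        = yes single
  nbWalk? (x ∷ y ∷ [])    with adj? x y
  ... | yes a  = yes (edge a)
  ... | no  ¬a = no λ { (edge a) → ¬a a }
  nbWalk? (x ∷ y ∷ z ∷ l) with adj? x y | x ≟ z | nbWalk? (y ∷ z ∷ l)
  ... | yes a  | no x≢z  | yes w  = yes (step a x≢z w)
  ... | no ¬a  | _       | _      = no λ { (step a _ _) → ¬a a }
  ... | yes _  | yes x≡z | _      = no λ { (step _ x≢z _) → x≢z x≡z }
  ... | yes _  | no _    | no ¬w  = no λ { (step _ _ w) → ¬w w }

  walk-adj : ∀ {x y l} → NBWalk (x ∷ y ∷ l) → Adj G x y
  walk-adj (edge a)     = a
  walk-adj (step a _ _) = a

  walk-noBacktrack : ∀ {x l} → NBWalk (x ∷ l) → NoBacktrack x l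
  walk-noBacktrack single        = tt
  walk-noBacktrack (edge _)      = tt
  walk-noBacktrack (step _ ne _) = ne

  walk-tail : ∀ {x l} → NBWalk (x ∷ l) → NBWalk l
  walk-tail single       = nil
  walk-tail (edge _)     = single
  walk-tail (step _ _ w) = w

  walk-cons : ∀ {x y l} → Adj G x y → NoBacktrack x (y ∷ l) → NBWalk (y ∷ l) →
              NBWalk (x ∷ y ∷ l)
  walk-cons {l = []}    a _  _ = edge a
  walk-cons {l = _ ∷ _} a nb w = step a nb w

  extend-or-backtrack : ∀ {m x y l} → Adj G m x → NBWalk (x ∷ y ∷ l) →
                        m ≡ y ⊎ NBWalk (m ∷ x ∷ y ∷ l)
  extend-or-backtrack {m} {y = y} a w with m ≟ y
  ... | yes m≡y = inj₁ m≡y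
  ... | no  m≢y = inj₂ (step a m≢y w)

  -- Gluing the reversal of one walk in front of another: the conditions say
  -- the junction xₕ – yₕ is an edge that backtracks on neither side.
  Joinable : List V → List V → Set
  Joinable (x ∷ xs) (y ∷ ys) = Adj G x y × NoBacktrack y (x ∷ xs) × NoBacktrack x (y ∷ ys)
  Joinable _ _               = ⊤

  walk-ʳ++ : ∀ xs ys → NBWalk xs → NBWalk ys → Joinable xs ys → NBWalk (xs ʳ++ ys)
  walk-ʳ++ []       ys wx wy j = wy
  walk-ʳ++ (x ∷ xs) [] wx wy j =
    walk-ʳ++ xs (x ∷ []) (walk-tail wx) single (joinable xs wx)
    where
    joinable : ∀ xs → NBWalk (x ∷ xs) → Joinable xs (x ∷ [])
    joinable []       _ = tt
    joinable (_ ∷ _)  w = adj-sym (walk-adj w) , walk-noBacktrack w , tt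
  walk-ʳ++ (x ∷ xs) (y ∷ ys) wx wy (a , nby , nbx) =
    walk-ʳ++ xs (x ∷ y ∷ ys) (walk-tail wx) (walk-cons a nbx wy) (joinable xs wx nby)
    where
    joinable : ∀ xs → NBWalk (x ∷ xs) → NoBacktrack y (x ∷ xs) → Joinable xs (x ∷ y ∷ ys)
    joinable []       _ _  = tt
    joinable (_ ∷ _)  w nb = adj-sym (walk-adj w) , walk-noBacktrack w , (λ e → nb (sym e))

  endpoint : V → List V → V
  endpoint z []      = z
  endpoint z (a ∷ A) = endpoint a A

  endpoint-∈ : ∀ z A → endpoint z A ∈L (z ∷ A)
  endpoint-∈ z []      = Any.here refl
  endpoint-∈ z (a ∷ A) = Any.there (endpoint-∈ a A)

  Distinct : List V → Set
  Distinct []       = ⊤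
  Distinct (x ∷ xs) = x ∉L xs × Distinct xs

  distinct-++ˡ : ∀ A B → Distinct (A ++ B) → Distinct A
  distinct-++ˡ []      B _         = tt
  distinct-++ˡ (a ∷ A) B (a∉ , d) = (λ a∈A → a∉ (∈-++⁺ˡ a∈A)) , distinct-++ˡ A B d

  distinct-ʳ++ʳ : ∀ xs ys → Distinct (xs ʳ++ ys) → Distinct ys
  distinct-ʳ++ʳ []       ys d = d
  distinct-ʳ++ʳ (x ∷ xs) ys d = proj₂ (distinct-ʳ++ʳ xs (x ∷ ys) d)

  shared-¬distinct : ∀ xs ys {x} → x ∈L xs → x ∈L ys → ¬ Distinct (xs ʳ++ ys)
  shared-¬distinct (x ∷ xs) ys (Any.here refl) x∈ys d = proj₁ (distinct-ʳ++ʳ xs (x ∷ ys) d) x∈ys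
  shared-¬distinct (y ∷ xs) ys (Any.there x∈xs) x∈ys d =
    shared-¬distinct xs (y ∷ ys) x∈xs (Any.there x∈ys) d

  lookup-injective : ∀ xs → Distinct xs → ∀ i j → lookup xs i ≡ lookup xs j → i ≡ j
  lookup-injective (x ∷ xs) d zero    zero    e = refl
  lookup-injective (x ∷ xs) d zero    (suc j) e = ⊥-elim (proj₁ d (subst (_∈L xs) (sym e) (∈-lookup j)))
  lookup-injective (x ∷ xs) d (suc i) zero    e = ⊥-elim (proj₁ d (subst (_∈L xs) e (∈-lookup i)))
  lookup-injective (x ∷ xs) d (suc i) (suc j) e = cong suc (lookup-injective xs (proj₂ d) i j e)

  splitAtFirst : ∀ {a} L → a ∈L L → Σ (List V) λ A → Σ (List V) λ B → L ≡ A ++ a ∷ B × a ∉L A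
  splitAtFirst (x ∷ L) (Any.here refl) = [] , L , refl , λ ()
  splitAtFirst {a} (x ∷ L) (Any.there a∈L) with a ≟ x
  ... | yes refl = [] , L , refl , λ ()
  ... | no  a≢x with splitAtFirst L a∈L
  ...   | A , B , refl , a∉A = x ∷ A , B , refl , λ { (Any.here e) → a≢x e ; (Any.there q) → a∉A q }

  -- A walk a ∷ A ++ a ∷ B runs through the cycle a ∷ A: the edges along a ∷ A
  -- and the closing edge from the last vertex of a ∷ A back to a.
  cycle-edges : ∀ a A rest → NBWalk (a ∷ A ++ rest) → ∀ (i : Fin (length A)) →
                Adj G (lookup (a ∷ A) (inject₁ i)) (lookup (a ∷ A) (suc i))
  cycle-edges a (x ∷ A) rest w zero    = walk-adj w
  cycle-edges a (x ∷ A) rest w (suc i) = cycle-edges x A rest (walk-tail w) i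

  cycle-closing : ∀ z A b B → NBWalk (z ∷ A ++ b ∷ B) →
                  Adj G (lookup (z ∷ A) (fromℕ (length A))) b
  cycle-closing z []      b B w = walk-adj w
  cycle-closing z (x ∷ A) b B w = cycle-closing x A b B (walk-tail w)

  -- With minimum degree ≥ 2 every vertex has a neighbour other than any given
  -- vertex, so every non-backtracking walk extends by one more step.
  module MinDegree (deg : MinDegreeAtLeast G 2) where

    neighbourAvoiding : ∀ v x → Σ V λ w → Adj G v w × w ≢ x
    neighbourAvoiding v x with any? (λ w → adj? v w ×-dec ¬? (w ≟ x))
    ... | yes found = found
    ... | no none   = ⊥-elim (2≰1 (begin
        2           ≤⟨ deg v ⟩
        degree G v  ≤⟨ p⊆q⇒∣p∣≤∣q∣ nbhd⊆⁅x⁆ ⟩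
        ∣ ⁅ x ⁆ ∣   ≡⟨ ∣⁅x⁆∣≡1 x ⟩
        1           ∎))
      where
      open ℕP.≤-Reasoning
      2≰1 : ¬ 2 ≤ 1
      2≰1 (s≤s ())
      nbhd⊆⁅x⁆ : nbhd G v ⊆ ⁅ x ⁆
      nbhd⊆⁅x⁆ {w} w∈ with w ≟ x
      ... | yes refl = x∈⁅x⁆ x
      ... | no  w≢x  = ⊥-elim (none (w , ∈-tabulate⁻ (adj v) w∈ , w≢x))

    next : V → V → V
    next x y = proj₁ (neighbourAvoiding x y)

    next-adj : ∀ x y → Adj G x (next x y)
    next-adj x y = proj₁ (proj₂ (neighbourAvoiding x y))

    next-≢ : ∀ x y → next x y ≢ y
    next-≢ x y = proj₂ (proj₂ (neighbourAvoiding x y))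

    next-walk : ∀ {x y l} → NBWalk (x ∷ y ∷ l) → NBWalk (next x y ∷ x ∷ y ∷ l)
    next-walk {x} {y} w = step (adj-sym (next-adj x y)) (next-≢ x y) w

  module Girth (g : ℕ) (girth : GirthAtLeast G (suc g)) where
    open ℕP.≤-Reasoning

    -- A closed walk a ∷ A ++ a ∷ B whose part a ∷ A is a path runs around the
    -- cycle a ∷ A, which therefore has at least g + 1 vertices.
    closed-walk-long : ∀ a A B → NBWalk (a ∷ A ++ a ∷ B) → a ∉L A → Distinct A →
                       g ≤ length A
    closed-walk-long a []          B w _ _ = ⊥-elim (adj-irrefl (walk-adj w))
    closed-walk-long a (x ∷ [])    B (step _ a≢a _) _ _ = ⊥-elim (a≢a refl)
    closed-walk-long a (x ∷ y ∷ A) B w a∉A distinctA = ℕP.≤-pred (girth _ _ isCycle)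
      where
      isCycle : IsCycle G (length (x ∷ y ∷ A)) (lookup (a ∷ x ∷ y ∷ A))
      isCycle = s≤s (s≤s (s≤s z≤n))
              , (λ {i} {j} → lookup-injective (a ∷ x ∷ y ∷ A) (a∉A , distinctA) i j)
              , cycle-edges a (x ∷ y ∷ A) (a ∷ B) w
              , cycle-closing a (x ∷ y ∷ A) a B w

    return-long : ∀ a L → NBWalk (a ∷ L) → Distinct L → a ∈L L → g < length L
    return-long a L w distinctL a∈L with splitAtFirst L a∈L
    ... | A , B , refl , a∉A = begin-strict
      g                     ≤⟨ closed-walk-long a A B w a∉A (distinct-++ˡ A (a ∷ B) distinctL) ⟩
      length A              <⟨ s≤s (LP.length-++-≤ˡ A) ⟩
      suc (length (A ++ B)) ≡⟨ LP.length-++-sucʳ A a B ⟨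
      length (A ++ a ∷ B)   ∎

    short-walk-distinct : ∀ L → NBWalk L → length L ≤ suc g → Distinct L
    short-walk-distinct []      _ _         = tt
    short-walk-distinct (a ∷ L) w (s≤s len) = a∉L , distinctL
      where
      distinctL = short-walk-distinct L (walk-tail w) (ℕP.m≤n⇒m≤1+n len)
      a∉L : a ∉L L
      a∉L a∈L = ℕP.<⇒≱ (return-long a L w distinctL a∈L) len

    short-walk-open : ∀ z b B → NBWalk (z ∷ b ∷ B) → length (b ∷ B) ≤ g → endpoint b B ≢ z
    short-walk-open z b B w len e =
      proj₁ (short-walk-distinct (z ∷ b ∷ B) w (s≤s len)) (subst (_∈L (b ∷ B)) e (endpoint-∈ b B))

    -- If 2k ≤ g, non-backtracking walks of length ≤ k with the same start and
    -- the same end coincide: otherwise one followed by the reverse of the other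
    -- is a walk with at most g + 1 vertices and a repetition.
    unique-walk : ∀ k → k + k ≤ g → ∀ z A B → NBWalk (z ∷ A) → NBWalk (z ∷ B) →
                  endpoint z A ≡ endpoint z B → length A ≤ k → length B ≤ k → A ≡ B
    unique-walk k 2k≤g z []      []      _  _  _ _  _  = refl
    unique-walk k 2k≤g z []      (b ∷ B) _  wB e _  lB =
      ⊥-elim (short-walk-open z b B wB (ℕP.≤-trans lB (ℕP.≤-trans (ℕP.m≤m+n k k) 2k≤g)) (sym e))
    unique-walk k 2k≤g z (a ∷ A) []      wA _  e lA _  =
      ⊥-elim (short-walk-open z a A wA (ℕP.≤-trans lA (ℕP.≤-trans (ℕP.m≤m+n k k) 2k≤g)) e)
    unique-walk k 2k≤g z (a ∷ A) (b ∷ B) wA wB e lA lB with a ≟ b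
    ... | yes refl = cong (a ∷_)
      (unique-walk k 2k≤g a A B (walk-tail wA) (walk-tail wB) e (ℕP.<⇒≤ lA) (ℕP.<⇒≤ lB))
    ... | no a≢b = ⊥-elim (shared-¬distinct (a ∷ A) (z ∷ b ∷ B)
        (endpoint-∈ a A) (Any.there (subst (_∈L (b ∷ B)) (sym e) (endpoint-∈ b B)))
        (short-walk-distinct C walkC lengthC))
      where
      C = (a ∷ A) ʳ++ (z ∷ b ∷ B)
      walkC : NBWalk C
      walkC = walk-ʳ++ (a ∷ A) (z ∷ b ∷ B) (walk-tail wA) wB
                (adj-sym (walk-adj wA) , walk-noBacktrack wA , a≢b)
      lengthC : length C ≤ suc g
      lengthC = begin
        length C                            ≡⟨ LP.length-ʳ++ (a ∷ A) ⟩
        length (a ∷ A) + length (z ∷ b ∷ B) ≤⟨ ℕP.+-mono-≤ lA (s≤s lB) ⟩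
        k + suc k                           ≡⟨ ℕP.+-suc k k ⟩
        suc (k + k)                         ≤⟨ s≤s 2k≤g ⟩
        suc g                               ∎

module Construction {n : ℕ} (G : SimpleGraph n) (girth : GirthAtLeast G 15)
                    (deg : MinDegreeAtLeast G 2) (p : Fin n) where
  open Graph G
  open Girth 14 girth
  open MinDegree deg

  -- Girth ≥ 15: walks of length ≤ 7 are determined by their ends.  The length
  -- bounds are checked by evaluation on the concrete walks used below.
  same-walk : ∀ z A B → NBWalk (z ∷ A) → NBWalk (z ∷ B) → endpoint z A ≡ endpoint z B →
              {True (length A ≤? 7)} → {True (length B ≤? 7)} → A ≡ B
  same-walk z A B wA wB e {lA} {lB} =
    unique-walk 7 ℕP.≤-refl z A B wA wB e (toWitness lA) (toWitness lB)

  different-lengths : ∀ z A B → NBWalk (z ∷ A) → NBWalk (z ∷ B) → endpoint z A ≡ endpoint z B →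
                      {True (length A ≤? 7)} → {True (length B ≤? 7)} →
                      {False (length A ℕ≟ length B)} → ⊥
  different-lengths z A B wA wB e {lA} {lB} {A≢B} =
    toWitnessFalse A≢B (cong length (same-walk z A B wA wB e {lA} {lB}))

  FiveWalk : V → V → Set
  FiveWalk r t = Σ V λ u → Σ V λ y → Σ V λ w → NBWalk (r ∷ t ∷ u ∷ y ∷ w ∷ p ∷ [])

  InSeed : V → Set
  InSeed x = x ≡ p ⊎ Σ V λ r → Σ V λ t → x ≡ next r t × FiveWalk r t

  inSeed? : Decidable InSeed
  inSeed? x = (x ≟ p) ⊎-dec any? λ r → any? λ t → (x ≟ next r t) ×-dec
              any? λ u → any? λ y → any? λ w → nbWalk? (r ∷ t ∷ u ∷ y ∷ w ∷ p ∷ [])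

  seed : Subset n
  seed = subsetOf inSeed?

  -- A common neighbour m of p and next r t would end walks to p of lengths 1
  -- and either 5 (m = r) or 7.
  root-child-apart : ∀ {m r t} → FiveWalk r t → Adj G p m → Adj G (next r t) m → ⊥
  root-child-apart {m} (u , y , w , walk) pm cm
    with extend-or-backtrack (adj-sym cm) (next-walk walk)
  ... | inj₁ refl  = different-lengths m (p ∷ []) _ (edge (adj-sym pm)) walk refl
  ... | inj₂ walk′ = different-lengths m (p ∷ []) _ (edge (adj-sym pm)) walk′ refl

  -- Two distinct children share no neighbour m: m would end two walks to p of
  -- lengths 5 or 7, which must then coincide.
  child-child-apart : ∀ {m r t r′ t′} → FiveWalk r t → FiveWalk r′ t′ → next r t ≢ next r′ t′ →
                      Adj G (next r t) m → Adj G (next r′ t′) m → ⊥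
  child-child-apart {m} (u , y , w , walk) (u′ , y′ , w′ , walk′) c≢c′ cm c′m
    with extend-or-backtrack (adj-sym cm) (next-walk walk)
       | extend-or-backtrack (adj-sym c′m) (next-walk walk′)
  ... | inj₁ refl | inj₁ refl =
    c≢c′ (cong (next m) (LP.∷-injectiveˡ (same-walk m _ _ walk walk′ refl)))
  ... | inj₁ refl | inj₂ long′ = different-lengths m _ _ walk long′ refl
  ... | inj₂ long | inj₁ refl  = different-lengths m _ _ long walk′ refl
  ... | inj₂ long | inj₂ long′ = c≢c′ (LP.∷-injectiveˡ (same-walk m _ _ long long′ refl))

  seed-openPacking : IsOpenPacking G seed
  seed-openPacking u v u∈ v∈ u≢v (m , um , vm)
    with ∈-subsetOf⁻ inSeed? u∈ | ∈-subsetOf⁻ inSeed? v∈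
  ... | inj₁ refl                | inj₁ refl                   = u≢v refl
  ... | inj₁ refl                | inj₂ (r , t , refl , five)   = root-child-apart five um vm
  ... | inj₂ (r , t , refl , five) | inj₁ refl                 = root-child-apart five vm um
  ... | inj₂ (r , t , refl , five) | inj₂ (_ , _ , refl , five′) =
    child-child-apart five five′ u≢v um vm

  p∈seed : p ∈ seed
  p∈seed = ∈-subsetOf⁺ inSeed? (inj₁ refl)

  -- An open packing containing the seed avoids every vertex t ending a 4-walk
  -- to p: r = next t u ends a 5-walk, so next r t is in the seed and shares
  -- the neighbour r with t.
  fourWalk-∉ : ∀ {P} → seed ⊆ P → IsOpenPacking G P →
               ∀ {t u y w} → NBWalk (t ∷ u ∷ y ∷ w ∷ p ∷ []) → t ∉ P
  fourWalk-∉ {P} seed⊆P opP {t} {u} {y} {w} walk t∈P =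
    opP t (next r t) t∈P child∈P (λ e → next-≢ r t (sym e)) (r , next-adj t u , adj-sym (next-adj r t))
    where
    r = next t u
    child∈P : next r t ∈ P
    child∈P = seed⊆P (∈-subsetOf⁺ inSeed? (inj₂ (r , t , refl , u , y , w , next-walk walk)))

  module Exchange (P : Subset n) (opP : IsOpenPacking G P) (p∈P : p ∈ P)
                  (far : ∀ {t u y w} → NBWalk (t ∷ u ∷ y ∷ w ∷ p ∷ []) → t ∉ P)
                  {y₁ w₁ y₂ w₂ : V}
                  (walk₁ : NBWalk (y₁ ∷ w₁ ∷ p ∷ [])) (walk₂ : NBWalk (y₂ ∷ w₂ ∷ p ∷ []))
                  (w₁≢w₂ : w₁ ≢ w₂) where

    Q₀ Q₁ Q : Subset n
    Q₀ = P [ p ]≔ outside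
    Q₁ = Q₀ [ y₁ ]≔ inside
    Q  = Q₁ [ y₂ ]≔ inside

    data Added : V → Set where
      first  : Added y₁
      second : Added y₂

    added-walk : ∀ {x} → Added x → Σ V λ w → NBWalk (x ∷ w ∷ p ∷ [])
    added-walk first  = w₁ , walk₁
    added-walk second = w₂ , walk₂

    -- An added vertex shares its middle neighbour with p, so it is not in P.
    added-∉P : ∀ {x} → Added x → x ∉ P
    added-∉P {x} a x∈P with added-walk a
    ... | w , walk =
      opP x p x∈P p∈P (walk-noBacktrack walk) (w , walk-adj walk , adj-sym (walk-adj (walk-tail walk)))

    -- y₁ and y₂ share no neighbour c: c would end walks to p of lengths 1 and 3,
    -- or two walks of length 3 through w₁ and w₂.
    added-apart : ∀ {c} → Adj G y₁ c → Adj G y₂ c → ⊥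
    added-apart {c} y₁c y₂c
      with extend-or-backtrack (adj-sym y₁c) walk₁ | extend-or-backtrack (adj-sym y₂c) walk₂
    ... | inj₁ c≡w₁  | inj₁ c≡w₂  = w₁≢w₂ (trans (sym c≡w₁) c≡w₂)
    ... | inj₁ refl  | inj₂ long₂ = different-lengths c _ _ (walk-tail walk₁) long₂ refl
    ... | inj₂ long₁ | inj₁ refl  = different-lengths c _ _ long₁ (walk-tail walk₂) refl
    ... | inj₂ long₁ | inj₂ long₂ =
      w₁≢w₂ (LP.∷-injectiveˡ (LP.∷-injectiveʳ (same-walk c _ _ long₁ long₂ refl)))

    y₁≢y₂ : y₁ ≢ y₂
    y₁≢y₂ y₁≡y₂ = added-apart (walk-adj walk₁) (subst (λ y → Adj G y w₁) y₁≡y₂ (walk-adj walk₁))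

    added-added-apart : ∀ {x x′ c} → Added x → Added x′ → x ≢ x′ → Adj G x c → Adj G x′ c → ⊥
    added-added-apart first  first  x≢x′ _   _   = x≢x′ refl
    added-added-apart first  second _    xc  x′c = added-apart xc x′c
    added-added-apart second first  _    xc  x′c = added-apart x′c xc
    added-added-apart second second x≢x′ _   _   = x≢x′ refl

    -- A vertex v ∈ P other than p shares no neighbour c with an added x ∷ w ∷ p:
    -- for c = w, v and p would share w; otherwise v ends a 4-walk to p.
    old-added-apart : ∀ {x v c} → Added x → v ∈ P → v ≢ p → v ≢ x →
                      Adj G x c → Adj G v c → ⊥
    old-added-apart {v = v} {c} a v∈P v≢p v≢x xc vc with added-walk a
    ... | w , walk with extend-or-backtrack (adj-sym xc) walk
    ...   | inj₁ refl = opP v p v∈P p∈P v≢p (c , vc , adj-sym (walk-adj (walk-tail walk)))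
    ...   | inj₂ long = far (step vc v≢x long) v∈P

    ∈Q⁻ : ∀ {x} → x ∈ Q → Added x ⊎ (x ≢ p × x ∈ P)
    ∈Q⁻ x∈Q with ∈-insert⁻ Q₁ y₂ x∈Q
    ... | inj₁ refl = inj₁ second
    ... | inj₂ x∈Q₁ with ∈-insert⁻ Q₀ y₁ x∈Q₁
    ...   | inj₁ refl = inj₁ first
    ...   | inj₂ x∈Q₀ = inj₂ (∈-remove⁻ P p x∈Q₀)

    Q-openPacking : IsOpenPacking G Q
    Q-openPacking u v u∈ v∈ u≢v (c , uc , vc) with ∈Q⁻ u∈ | ∈Q⁻ v∈
    ... | inj₁ a           | inj₁ b           = added-added-apart a b u≢v uc vc
    ... | inj₁ a           | inj₂ (v≢p , v∈P) = old-added-apart a v∈P v≢p (λ e → u≢v (sym e)) uc vc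
    ... | inj₂ (u≢p , u∈P) | inj₁ b           = old-added-apart b u∈P u≢p u≢v vc uc
    ... | inj₂ (_ , u∈P)   | inj₂ (_ , v∈P)   = opP u v u∈P v∈P u≢v (c , uc , vc)

    ∣Q∣≡1+∣P∣ : ∣ Q ∣ ≡ suc ∣ P ∣
    ∣Q∣≡1+∣P∣ = begin
      ∣ Q ∣            ≡⟨ ∣insert∣ Q₁ y₂ y₂∉Q₁ ⟩
      suc ∣ Q₁ ∣       ≡⟨ cong suc (∣insert∣ Q₀ y₁ y₁∉Q₀) ⟩
      suc (suc ∣ Q₀ ∣) ≡⟨ cong suc (∣remove∣ P p p∈P) ⟩
      suc ∣ P ∣        ∎
      where
      open ≡-Reasoning
      y₁∉Q₀ : y₁ ∉ Q₀
      y₁∉Q₀ y₁∈Q₀ = added-∉P first (proj₂ (∈-remove⁻ P p y₁∈Q₀))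
      y₂∉Q₁ : y₂ ∉ Q₁
      y₂∉Q₁ y₂∈Q₁ with ∈-insert⁻ Q₀ y₁ y₂∈Q₁
      ... | inj₁ y₂≡y₁ = y₁≢y₂ (sym y₂≡y₁)
      ... | inj₂ y₂∈Q₀ = added-∉P second (proj₂ (∈-remove⁻ P p y₂∈Q₀))

  w₁ w₂ : V
  w₁ = next p p
  w₂ = next p w₁

  walk₁ : NBWalk (next w₁ p ∷ w₁ ∷ p ∷ [])
  walk₁ = next-walk (edge (adj-sym (next-adj p p)))

  walk₂ : NBWalk (next w₂ p ∷ w₂ ∷ p ∷ [])
  walk₂ = next-walk (edge (adj-sym (next-adj p w₁)))

  w₁≢w₂ : w₁ ≢ w₂
  w₁≢w₂ e = next-≢ p w₁ (sym e)

lemma2 : ∀ {n : ℕ} (G : SimpleGraph n) → 1 ≤ n →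
    GirthAtLeast G 15 → MinDegreeAtLeast G 2 →
    Σ (Subset n) λ P → Σ (Subset n) λ Q →
      IsMaximalOpenPacking G P × IsMaximalOpenPacking G Q × ∣ P ∣ ≢ ∣ Q ∣
lemma2 {suc k} G _ girth deg =
  P , Q′ , P-maximal , Q′-maximal , λ ∣P∣≡∣Q′∣ → ℕP.<-irrefl ∣P∣≡∣Q′∣ ∣P∣<∣Q′∣
  where
  open Graph G using (extendToMaximal)
  open Construction G girth deg zero

  extendedSeed : Σ (Subset (suc k)) λ P → seed ⊆ P × IsMaximalOpenPacking G P
  extendedSeed = extendToMaximal seed seed-openPacking

  P : Subset (suc k)
  P = proj₁ extendedSeed

  seed⊆P : seed ⊆ P
  seed⊆P = proj₁ (proj₂ extendedSeed)

  P-maximal : IsMaximalOpenPacking G P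
  P-maximal = proj₂ (proj₂ extendedSeed)

  open Exchange P (proj₁ P-maximal) (seed⊆P p∈seed) (fourWalk-∉ seed⊆P (proj₁ P-maximal))
                walk₁ walk₂ w₁≢w₂

  extendedQ : Σ (Subset (suc k)) λ Q′ → Q ⊆ Q′ × IsMaximalOpenPacking G Q′
  extendedQ = extendToMaximal Q Q-openPacking

  Q′ : Subset (suc k)
  Q′ = proj₁ extendedQ

  Q′-maximal : IsMaximalOpenPacking G Q′
  Q′-maximal = proj₂ (proj₂ extendedQ)

  ∣P∣<∣Q′∣ : ∣ P ∣ < ∣ Q′ ∣
  ∣P∣<∣Q′∣ = subst (_≤ ∣ Q′ ∣) ∣Q∣≡1+∣P∣ (p⊆q⇒∣p∣≤∣q∣ (proj₁ (proj₂ extendedQ)))
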